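{- Let $N$ be a positive integer, $k\ge2$ an integer, $\mathbf c\in\mathcal C(N,k)$, and let $\mathcal C(\mathbf c_0),\ldots,\mathcal C(\mathbf c_{k-1})$ be defined as below. Setting $S(\mathbf c_j)=\sum_{\mathbf d\in\mathcal C(\mathbf c_j)}\binom{N}{d_0,\ldots,d_{k-1}}$, we have $$\sum_{j=0}^{k-1}S(\mathbf c_j)=k^N.$$
   Context: $\mathcal C(N,k)$ is the set of weak compositions $\mathbf d=(d_0,\ldots,d_{k-1})$ of $N$ into $k$ parts. For $\mathbf c=(c_0,\ldots,c_{k-1})\in\mathcal C(N,k)$ with $\mathbf e_0,\ldots,\mathbf e_{k-1}$ the standard basis of $\mathbb Z^k$, set $\mathbf c_0=\mathbf c$ and $\mathbf c_j=(c_{j,0},\ldots,c_{j,k-1})=\mathbf c+\mathbf e_{k-1}-\mathbf e_{j-1}$ for $1\le j\le k-1$. Then $\mathcal C(\mathbf c_j)=\{\mathbf d\in\mathcal C(N,k): d_j+\cdots+d_{j+i}\ge c_{j,j}+\cdots+c_{j,j+i}\text{ for }i=0,\ldots,k-2\}$ with indices modulo $k$, and $\mathcal C(\mathbf c_j)=\emptyset$ if $\mathbf c_j$ has a negative entry. $\binom{N}{d_0,\ldots,d_{k-1}}$ is the multinomial coefficient. -}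

module Defs where

open import Data.Nat using (ℕ; zero; suc; _+_; _*_; _^_; _≤_; _∸_; NonZero)
open import Data.Nat.Properties using (m*n≢0)
open import Data.Nat.DivMod using (_/_; _%_)
open import Data.Nat using (_!)
open import Data.Nat.Properties using (_!≢0)
open import Data.Integer as ℤ using (ℤ; +_)
open import Data.Bool using (Bool; true; false; _∧_; if_then_else_)
open import Data.List as List using (List; []; _∷_; upTo; concatMap; filter; map)
open import Data.Vec as Vec using (Vec; []; _∷_; toList; tabulate; lookup)
open import Data.Fin using (Fin; toℕ)
open import Relation.Nullary.Decidable using (⌊_⌋)
open import Data.Nat using (_≟_; _≤ᵇ_)

sumℕ : List ℕ → ℕ
sumℕ = List.foldr _+_ 0

sumℤ : List ℤ → ℤ
sumℤ = List.foldr ℤ._+_ (+ 0)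

box : ℕ → (k : ℕ) → List (Vec ℕ k)
box N zero    = [] ∷ []
box N (suc k) = concatMap (λ a → map (a ∷_) (box N k)) (upTo (suc N))

comps : ℕ → (k : ℕ) → List (Vec ℕ k)
comps N k = filter (λ d → sumℕ (toList d) ≟ N) (box N k)

-- Multinomial coefficient (d_0+…+d_{k-1})! / (d_0! ⋯ d_{k-1}!)
-- (for d ∈ C(N,k) the numerator is N!)
prodFact : List ℕ → ℕ
prodFact []       = 1
prodFact (x ∷ xs) = x ! * prodFact xs

prodFact≢0 : ∀ xs → NonZero (prodFact xs)
prodFact≢0 []       = _
prodFact≢0 (x ∷ xs) = m*n≢0 (x !) (prodFact xs) {{x !≢0}} {{prodFact≢0 xs}}

multinomial : ℕ → List ℕ → ℕ
multinomial N ds = _/_ (N !) (prodFact ds) {{prodFact≢0 ds}}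

modk : ℕ → ℕ → ℕ
modk zero    n = n
modk (suc k) n = n % suc k

nth : {A : Set} → A → List A → ℕ → A
nth a []       _       = a
nth a (x ∷ xs) zero    = x
nth a (x ∷ xs) (suc n) = nth a xs n

-- c_j as an integer vector: c_0 = c, c_j = c + e_{k-1} - e_{j-1} (1 ≤ j ≤ k-1)
indicator : ℕ → ℕ → ℤ
indicator i t = if ⌊ i ≟ t ⌋ then + 1 else + 0

cvec : {k : ℕ} → Vec ℕ k → ℕ → Vec ℤ k
cvec {k} c zero    = Vec.map +_ c
cvec {k} c (suc j) =
  tabulate (λ (i : Fin k) →
    ((+ lookup c i) ℤ.+ indicator (toℕ i) (k ∸ 1)) ℤ.- indicator (toℕ i) j)

-- Boolean test for d ∈ C(c_j): C(c_j) is empty if c_j has a negative entry;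
-- otherwise d_j+⋯+d_{j+i} ≥ c_{j,j}+⋯+c_{j,j+i} for i = 0,…,k-2 (indices mod k)
nonNeg : {k : ℕ} → Vec ℤ k → Bool
nonNeg v = List.foldr _∧_ true (map (λ x → + 0 ℤ.≤ᵇ x) (toList v))

inC : {k : ℕ} → Vec ℕ k → ℕ → Vec ℕ k → Bool
inC {k} c j d =
  nonNeg (cvec c j) ∧
  List.foldr _∧_ true
    (map (λ i →
       sumℤ (map (λ t → nth (+ 0) (toList (cvec c j)) (modk k (j + t))) (upTo (suc i)))
       ℤ.≤ᵇ
       sumℤ (map (λ t → + nth 0 (toList d) (modk k (j + t))) (upTo (suc i))))
     (upTo (k ∸ 1)))

S : (N k : ℕ) → Vec ℕ k → ℕ → ℕ
S N k c j = sumℕ (map (λ d → multinomial N (toList d)) (List.filterᵇ (inC c j) (comps N k)))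

-- Put Q(m) = Σ_{t<m} (d_t − c_t), so that Q(0) = Q(k) = 0 when d ∈ C(N,k). Passing from c to c_j
-- (j ≥ 1) raises the partial sums of d − c_j by one exactly on [j, k−1], so the cyclic window
-- conditions defining C(c_j) say that Q(j) ≤ Q(m) for j < m ≤ k−1 and Q(j) < Q(m) for m < j:
-- d ∈ C(c_j) iff j is the first index of [0, k−1] at which Q attains its minimum (and then
-- c_{j−1} > d_{j−1} ≥ 0, so c_j has no negative entry). Hence C(c_0), …, C(c_{k−1}) partition
-- C(N,k), and Σ_j S(c_j) is the sum of all multinomial coefficients, k^N by the multinomial
-- theorem, which follows from the binomial theorem by induction on k.

module Submission where

open import Defs

module SumsOfNaturals where

  open import Data.Bool using (Bool; true; false; T; if_then_else_)
  open import Data.List using (List; []; _∷_; _++_; map; filter; filterᵇ; concatMap; applyUpTo)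
  open import Data.List.Properties using (map-++; map-cong; map-cong-local)
  import Data.List.Relation.Unary.All as All
  open import Data.List.Relation.Unary.All.Properties using (all-filter)
  open import Data.Nat using (ℕ; zero; suc; _+_; _*_; _≤_; _<_; z≤n; s≤s)
  open import Data.Nat.ListAction using (sum)
  open import Data.Nat.ListAction.Properties using (sum-++)
  open import Data.Nat.Properties
  open import Algebra.Properties.CommutativeSemigroup +-commutativeSemigroup using (interchange)
  open import Function using (_∘_; _⇔_; mk⇔; Equivalence)
  open import Relation.Binary.PropositionalEquality
  open import Relation.Nullary using (¬_; does)
  open import Relation.Nullary.Decidable using (T?)
  open import Relation.Nullary.Negation using (contradiction)
  open import Relation.Unary using (Decidable)

  private
    variable
      A B : Set

  sum-map-+ : ∀ (f g : A → ℕ) xs → sum (map (λ x → f x + g x) xs) ≡ sum (map f xs) + sum (map g xs)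
  sum-map-+ f g []       = refl
  sum-map-+ f g (x ∷ xs) =
    trans (cong (f x + g x +_) (sum-map-+ f g xs)) (interchange (f x) (g x) _ _)

  sum-map-*ˡ : ∀ m (f : A → ℕ) xs → sum (map (λ x → m * f x) xs) ≡ m * sum (map f xs)
  sum-map-*ˡ m f []       = sym (*-zeroʳ m)
  sum-map-*ˡ m f (x ∷ xs) =
    trans (cong (m * f x +_) (sum-map-*ˡ m f xs)) (sym (*-distribˡ-+ m (f x) _))

  sum-map-cong : ∀ {f g : A → ℕ} → (∀ x → f x ≡ g x) → ∀ xs → sum (map f xs) ≡ sum (map g xs)
  sum-map-cong f≗g xs = cong sum (map-cong f≗g xs)

  sum-map-concatMap : ∀ (f : B → ℕ) (g : A → List B) xs →
    sum (map f (concatMap g xs)) ≡ sum (map (λ x → sum (map f (g x))) xs)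
  sum-map-concatMap f g []       = refl
  sum-map-concatMap f g (x ∷ xs) = begin
    sum (map f (g x ++ concatMap g xs))                      ≡⟨ cong sum (map-++ f (g x) _) ⟩
    sum (map f (g x) ++ map f (concatMap g xs))              ≡⟨ sum-++ (map f (g x)) _ ⟩
    sum (map f (g x)) + sum (map f (concatMap g xs))        ≡⟨ cong (sum (map f (g x)) +_) (sum-map-concatMap f g xs) ⟩
    sum (map f (g x)) + sum (map (λ x → sum (map f (g x))) xs) ∎
    where open ≡-Reasoning

  sum-map-filter : ∀ {P : A → Set} (P? : Decidable P) (f : A → ℕ) xs →
    sum (map f (filter P? xs)) ≡ sum (map (λ x → if does (P? x) then f x else 0) xs)
  sum-map-filter P? f []       = refl
  sum-map-filter P? f (x ∷ xs) with does (P? x)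
  ... | true  = cong (f x +_) (sum-map-filter P? f xs)
  ... | false = sum-map-filter P? f xs

  sum-map-comm : ∀ (f : A → B → ℕ) xs ys →
    sum (map (λ x → sum (map (f x) ys)) xs) ≡ sum (map (λ y → sum (map (λ x → f x y) xs)) ys)
  sum-map-comm f []       ys = sym (sum-map-*ˡ 0 (λ _ → 0) ys)
  sum-map-comm f (x ∷ xs) ys =
    trans (cong (sum (map (f x) ys) +_) (sum-map-comm f xs ys)) (sym (sum-map-+ (f x) _ ys))

  sum-map-filter-cong : ∀ {P : A → Set} (P? : Decidable P) {f g : A → ℕ} →
    (∀ {x} → P x → f x ≡ g x) → ∀ xs → sum (map f (filter P? xs)) ≡ sum (map g (filter P? xs))
  sum-map-filter-cong P? f≡g xs = cong sum (map-cong-local (All.map f≡g (all-filter P? xs)))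

  double-counting : ∀ (p : A → B → Bool) (f : B → ℕ) xs ys →
    sum (map (λ x → sum (map f (filterᵇ (p x) ys))) xs) ≡
    sum (map (λ y → f y * sum (map (λ x → if p x y then 1 else 0) xs)) ys)
  double-counting p f xs ys = begin
    sum (map (λ x → sum (map f (filterᵇ (p x) ys))) xs)
      ≡⟨ sum-map-cong (λ x → sum-map-filter (T? ∘ p x) f ys) xs ⟩
    sum (map (λ x → sum (map (λ y → if p x y then f y else 0) ys)) xs)
      ≡⟨ sum-map-comm (λ x y → if p x y then f y else 0) xs ys ⟩
    sum (map (λ y → sum (map (λ x → if p x y then f y else 0) xs)) ys)
      ≡⟨ sum-map-cong (λ y → trans (sum-map-cong (λ x → if-factor (p x y) (f y)) xs)
                                   (sum-map-*ˡ (f y) (λ x → if p x y then 1 else 0) xs)) ys ⟩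
    sum (map (λ y → f y * sum (map (λ x → if p x y then 1 else 0) xs)) ys) ∎
    where
    open ≡-Reasoning
    if-factor : ∀ b m → (if b then m else 0) ≡ m * (if b then 1 else 0)
    if-factor true  m = sym (*-identityʳ m)
    if-factor false m = sym (*-zeroʳ m)

  sum-applyUpTo-≡0 : ∀ {f : ℕ → ℕ} n → (∀ {i} → i < n → f i ≡ 0) → sum (applyUpTo f n) ≡ 0
  sum-applyUpTo-≡0 zero    f≡0 = refl
  sum-applyUpTo-≡0 (suc n) f≡0 = cong₂ _+_ (f≡0 (s≤s z≤n)) (sum-applyUpTo-≡0 n (λ i<n → f≡0 (s≤s i<n)))

  sum-applyUpTo-extend : ∀ {f : ℕ → ℕ} {m} n → (∀ {i} → n ≤ i → f i ≡ 0) → n ≤ m →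
    sum (applyUpTo f m) ≡ sum (applyUpTo f n)
  sum-applyUpTo-extend {m = m} zero f≡0 _ = sum-applyUpTo-≡0 m (λ _ → f≡0 z≤n)
  sum-applyUpTo-extend {f = f} (suc n) f≡0 (s≤s n≤m) =
    cong (f 0 +_) (sum-applyUpTo-extend {f = λ i → f (suc i)} n (λ n≤i → f≡0 (s≤s n≤i)) n≤m)

  private
    if-false : ∀ {x} → ¬ T x → (if x then 1 else 0) ≡ 0
    if-false {false} _  = refl
    if-false {true}  ¬t = contradiction _ ¬t

  sum-indicator≡1 : ∀ (b : ℕ → Bool) n {j₀} → j₀ < n → (∀ {j} → j < n → T (b j) ⇔ j ≡ j₀) →
    sum (applyUpTo (λ j → if b j then 1 else 0) n) ≡ 1
  sum-indicator≡1 b (suc n) {zero}   _          b⇔ =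
    cong₂ _+_ (if-true (Equivalence.from (b⇔ (s≤s z≤n)) refl))
              (sum-applyUpTo-≡0 n (λ j<n → if-false (λ bⱼ → 1+n≢0 (Equivalence.to (b⇔ (s≤s j<n)) bⱼ))))
    where
    if-true : ∀ {x} → T x → (if x then 1 else 0) ≡ 1
    if-true {true} _ = refl
  sum-indicator≡1 b (suc n) {suc j₀} (s≤s j₀<n) b⇔ =
    cong₂ _+_ (if-false (λ b₀ → 0≢1+n (Equivalence.to (b⇔ (s≤s z≤n)) b₀)))
              (sum-indicator≡1 (b ∘ suc) n j₀<n b∘suc⇔)
    where
    b∘suc⇔ : ∀ {j} → j < n → T (b (suc j)) ⇔ j ≡ j₀
    b∘suc⇔ j<n = mk⇔ (suc-injective ∘ Equivalence.to (b⇔ (s≤s j<n)))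
                     (Equivalence.from (b⇔ (s≤s j<n)) ∘ cong suc)

module MultinomialTheorem where

  open import Data.Bool using (if_then_else_)
  open import Data.Fin using (toℕ)
  open import Data.List using (List; []; _∷_; map; filter; concatMap; applyUpTo; upTo)
  open import Data.List.Properties using (map-upTo; map-∘)
  open import Data.Nat using (ℕ; zero; suc; _+_; _*_; _∸_; _^_; _≤_; s≤s; _!)
  open import Data.Nat.Combinatorics using (_C_; nCk≡n!/k![n-k]!; k![n∸k]!∣n!; k>n⇒nCk≡0)
  open import Data.Nat.DivMod using (_/_; m/n*n≡m; m*n/n≡m)
  open import Data.Nat.ListAction using (sum)
  open import Data.Nat.Properties
  open import Algebra.Properties.CommutativeSemigroup *-commutativeSemigroup using (x∙yz≈y∙xz)
  import Algebra.Properties.CommutativeSemiring.Binomial +-*-commutativeSemiring as Binomial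
  open import Algebra.Properties.Monoid.Mult +-0-monoid using () renaming (_×_ to _×ᴹ_)
  open import Algebra.Properties.Monoid.Sum +-0-monoid using (sum-syntax; sum⁺-syntax; sum-cong-≗)
  open import Algebra.Properties.Semiring.Exp +-*-semiring using () renaming (_^_ to _^ᴹ_)
  open import Data.Vec using (Vec; toList; _∷_)
  open import Function using (_∘_)
  open import Relation.Binary.PropositionalEquality
  open import Relation.Nullary using (Dec; does; yes; no; ¬_)
  open import Relation.Nullary.Negation using (contradiction)
  open SumsOfNaturals

  ×ᴹ≡* : ∀ m n → m ×ᴹ n ≡ m * n
  ×ᴹ≡* zero    n = refl
  ×ᴹ≡* (suc m) n = cong (n +_) (×ᴹ≡* m n)

  ^ᴹ≡^ : ∀ x n → x ^ᴹ n ≡ x ^ n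
  ^ᴹ≡^ x zero    = refl
  ^ᴹ≡^ x (suc n) = cong (x *_) (^ᴹ≡^ x n)

  ∑≡sum-applyUpTo : ∀ n (f : ℕ → ℕ) → ∑[ i < n ] f (toℕ i) ≡ sum (applyUpTo f n)
  ∑≡sum-applyUpTo zero    f = refl
  ∑≡sum-applyUpTo (suc n) f = cong (f 0 +_) (∑≡sum-applyUpTo n (λ i → f (suc i)))

  binomial-theorem : ∀ n x → sum (applyUpTo (λ a → (n C a) * x ^ (n ∸ a)) (suc n)) ≡ suc x ^ n
  binomial-theorem n x = sym (begin
    suc x ^ n
      ≡⟨ ^ᴹ≡^ (suc x) n ⟨
    (1 + x) ^ᴹ n
      ≡⟨ Binomial.theorem n 1 x ⟩
    ∑[ a ≤ n ] ((n C toℕ a) ×ᴹ (1 ^ᴹ toℕ a * x ^ᴹ (n ∸ toℕ a)))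
      ≡⟨ sum-cong-≗ {suc n} (term ∘ toℕ) ⟩
    ∑[ a ≤ n ] ((n C toℕ a) * x ^ (n ∸ toℕ a))
      ≡⟨ ∑≡sum-applyUpTo (suc n) (λ a → (n C a) * x ^ (n ∸ a)) ⟩
    sum (applyUpTo (λ a → (n C a) * x ^ (n ∸ a)) (suc n)) ∎)
    where
    open ≡-Reasoning
    term : ∀ a → (n C a) ×ᴹ (1 ^ᴹ a * x ^ᴹ (n ∸ a)) ≡ (n C a) * x ^ (n ∸ a)
    term a = begin
      (n C a) ×ᴹ (1 ^ᴹ a * x ^ᴹ (n ∸ a))
        ≡⟨ ×ᴹ≡* (n C a) _ ⟩
      (n C a) * (1 ^ᴹ a * x ^ᴹ (n ∸ a))
        ≡⟨ cong₂ (λ u v → (n C a) * (u * v)) (trans (^ᴹ≡^ 1 a) (^-zeroˡ a)) (^ᴹ≡^ x (n ∸ a)) ⟩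
      (n C a) * (1 * x ^ (n ∸ a))
        ≡⟨ cong ((n C a) *_) (*-identityˡ (x ^ (n ∸ a))) ⟩
      (n C a) * x ^ (n ∸ a) ∎

  binomial-sum : ∀ {n m} x → n ≤ m → sum (map (λ a → (n C a) * x ^ (n ∸ a)) (upTo (suc m))) ≡ suc x ^ n
  binomial-sum {n} {m} x n≤m = begin
    sum (map term (upTo (suc m)))
      ≡⟨ cong sum (map-upTo term (suc m)) ⟩
    sum (applyUpTo term (suc m))
      ≡⟨ sum-applyUpTo-extend (suc n) (λ {a} n<a → cong (_* x ^ (n ∸ a)) (k>n⇒nCk≡0 n<a)) (s≤s n≤m) ⟩
    sum (applyUpTo term (suc n))
      ≡⟨ binomial-theorem n x ⟩
    suc x ^ n ∎
    where
    open ≡-Reasoning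
    term : ℕ → ℕ
    term a = (n C a) * x ^ (n ∸ a)

  nCk*[k!*[n∸k]!]≡n! : ∀ {n k} → k ≤ n → (n C k) * (k ! * (n ∸ k) !) ≡ n !
  nCk*[k!*[n∸k]!]≡n! {n} {k} k≤n =
    trans (cong (_* (k ! * (n ∸ k) !)) (nCk≡n!/k![n-k]! k≤n))
          (m/n*n≡m {{m*n≢0 (k !) ((n ∸ k) !) {{k !≢0}} {{(n ∸ k) !≢0}}}} (k![n∸k]!∣n! k≤n))

  multinomial′ : List ℕ → ℕ
  multinomial′ []       = 1
  multinomial′ (a ∷ ds) = ((a + sum ds) C a) * multinomial′ ds

  multinomial′*prodFact≡sum! : ∀ ds → multinomial′ ds * prodFact ds ≡ sum ds !
  multinomial′*prodFact≡sum! []       = refl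
  multinomial′*prodFact≡sum! (a ∷ ds) = begin
    (Cₐ * multinomial′ ds) * (a ! * prodFact ds)  ≡⟨ *-assoc Cₐ (multinomial′ ds) (a ! * prodFact ds) ⟩
    Cₐ * (multinomial′ ds * (a ! * prodFact ds))  ≡⟨ cong (Cₐ *_) (x∙yz≈y∙xz (multinomial′ ds) (a !) (prodFact ds)) ⟩
    Cₐ * (a ! * (multinomial′ ds * prodFact ds))  ≡⟨ cong (λ m → Cₐ * (a ! * m)) (multinomial′*prodFact≡sum! ds) ⟩
    Cₐ * (a ! * s !)                              ≡⟨ cong (λ m → Cₐ * (a ! * m !)) (m+n∸m≡n a s) ⟨
    Cₐ * (a ! * (a + s ∸ a) !)                    ≡⟨ nCk*[k!*[n∸k]!]≡n! (m≤m+n a s) ⟩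
    (a + s) !                                     ∎
    where
    open ≡-Reasoning
    s = sum ds
    Cₐ = (a + s) C a

  multinomial≡multinomial′ : ∀ ds → multinomial (sum ds) ds ≡ multinomial′ ds
  multinomial≡multinomial′ ds =
    trans (cong (λ m → _/_ m (prodFact ds) {{prodFact≢0 ds}}) (sym (multinomial′*prodFact≡sum! ds)))
          (m*n/n≡m (multinomial′ ds) (prodFact ds) {{prodFact≢0 ds}})

  weight : ℕ → List ℕ → ℕ
  weight N ds = if does (sum ds ≟ N) then multinomial′ ds else 0

  weight-∷ : ∀ N a ds → weight N (a ∷ ds) ≡ (N C a) * weight (N ∸ a) ds
  weight-∷ N a ds = by-cases (a + s ≟ N) (s ≟ N ∸ a)
    where
    s = sum ds
    M = multinomial′ ds
    by-cases : (p : Dec (a + s ≡ N)) (q : Dec (s ≡ N ∸ a)) →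
      (if does p then ((a + s) C a) * M else 0) ≡ (N C a) * (if does q then M else 0)
    by-cases (yes a+s≡N) (yes _)     = cong (λ n → (n C a) * M) a+s≡N
    by-cases (yes a+s≡N) (no s≢N∸a)  = contradiction (trans (sym (m+n∸m≡n a s)) (cong (_∸ a) a+s≡N)) s≢N∸a
    by-cases (no a+s≢N)  (yes s≡N∸a) = sym (cong (_* M) (k>n⇒nCk≡0 (≰⇒> a≰N)))
      where
      a≰N : ¬ a ≤ N
      a≰N a≤N = a+s≢N (trans (cong (a +_) s≡N∸a) (m+[n∸m]≡n a≤N))
    by-cases (no _)      (no _)      = sym (*-zeroʳ (N C a))

  -- The bound B of the box stays fixed while N decreases along the recursion.
  sum-weight-box : ∀ B N k → N ≤ B → sum (map (weight N ∘ toList) (box B k)) ≡ k ^ N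
  sum-weight-box B zero    zero    _   = refl
  sum-weight-box B (suc N) zero    _   = refl
  sum-weight-box B N       (suc k) N≤B = begin
    sum (map w (concatMap (λ a → map (a ∷_) (box B k)) (upTo (suc B))))
      ≡⟨ sum-map-concatMap w (λ a → map (a ∷_) (box B k)) (upTo (suc B)) ⟩
    sum (map (λ a → sum (map w (map (a ∷_) (box B k)))) (upTo (suc B)))
      ≡⟨ sum-map-cong column (upTo (suc B)) ⟩
    sum (map (λ a → (N C a) * k ^ (N ∸ a)) (upTo (suc B)))
      ≡⟨ binomial-sum k N≤B ⟩
    suc k ^ N ∎
    where
    open ≡-Reasoning
    w : Vec ℕ (suc k) → ℕ
    w = weight N ∘ toList
    column : ∀ a → sum (map w (map (a ∷_) (box B k))) ≡ (N C a) * k ^ (N ∸ a)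
    column a = begin
      sum (map w (map (a ∷_) (box B k)))
        ≡⟨ cong sum (map-∘ (box B k)) ⟨
      sum (map (λ d → weight N (a ∷ toList d)) (box B k))
        ≡⟨ sum-map-cong (weight-∷ N a ∘ toList) (box B k) ⟩
      sum (map (λ d → (N C a) * weight (N ∸ a) (toList d)) (box B k))
        ≡⟨ sum-map-*ˡ (N C a) (weight (N ∸ a) ∘ toList) (box B k) ⟩
      (N C a) * sum (map (weight (N ∸ a) ∘ toList) (box B k))
        ≡⟨ cong ((N C a) *_) (sum-weight-box B (N ∸ a) k (≤-trans (m∸n≤m N a) N≤B)) ⟩
      (N C a) * k ^ (N ∸ a) ∎

  multinomial-theorem : ∀ N k → sum (map (λ d → multinomial N (toList d)) (comps N k)) ≡ k ^ N
  multinomial-theorem N k = begin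
    sum (map (multinomial N ∘ toList) (filter P? (box N k)))
      ≡⟨ sum-map-filter P? (multinomial N ∘ toList) (box N k) ⟩
    sum (map (λ d → if does (P? d) then multinomial N (toList d) else 0) (box N k))
      ≡⟨ sum-map-cong term (box N k) ⟩
    sum (map (weight N ∘ toList) (box N k))
      ≡⟨ sum-weight-box N N k ≤-refl ⟩
    k ^ N ∎
    where
    open ≡-Reasoning
    P? : ∀ (d : Vec ℕ k) → Dec (sum (toList d) ≡ N)
    P? d = sum (toList d) ≟ N
    term : ∀ d → (if does (P? d) then multinomial N (toList d) else 0) ≡ weight N (toList d)
    term d = agree (P? d)
      where
      agree : (p : Dec (sum (toList d) ≡ N)) →
        (if does p then multinomial N (toList d) else 0) ≡ (if does p then multinomial′ (toList d) else 0)
      agree (yes refl) = multinomial≡multinomial′ (toList d)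
      agree (no _)     = refl

module CycleLemma where

  open import Data.Bool using (Bool; T; if_then_else_)
  open import Data.Bool.Properties using (T-∧)
  open import Data.Fin as Fin using (Fin; toℕ; fromℕ<)
  open import Data.Fin.Properties using (toℕ-fromℕ<)
  open import Data.Integer using (ℤ; +_; 0ℤ; 1ℤ; -_; _+_; _-_; _≤_; _<_; _≤ᵇ_; +≤+)
  import Data.Integer.Properties as ℤ
  open import Data.Integer.Tactic.RingSolver using (solve-∀)
  open import Data.List using ([]; _∷_; map; applyUpTo; upTo)
  open import Data.List.Properties using (map-upTo)
  open import Data.List.Relation.Unary.All.Properties using (all⁺; all⁻; applyUpTo⁺₁; applyUpTo⁻)
  open import Data.Vec.Relation.Unary.All.Properties using (toList⁺; lookup⁻)
  open import Data.Nat as ℕ using (ℕ; zero; suc; _∸_; z≤n; s≤s; _≟_)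
  import Data.Nat.Properties as ℕ
  open import Data.Nat.DivMod using (_%_; m<n⇒m%n≡m; [m+n]%n≡m%n)
  open import Data.Nat.ListAction using (sum)
  open import Data.Product using (∃; _,_; proj₁; proj₂)
  open import Data.Sum using (inj₁; inj₂)
  open import Data.Vec as Vec using (Vec; toList; lookup; tabulate)
  open import Data.Vec.Properties using (toList-map; lookup∘tabulate; lookup-map)
  open import Function using (_∘_; _⇔_; mk⇔; Equivalence)
  open import Relation.Binary.Definitions using (tri<; tri≈; tri>)
  open import Relation.Binary.PropositionalEquality
  open import Relation.Nullary using (yes; no)
  open import Relation.Nullary.Negation using (contradiction)
  open import Relation.Nullary.Decidable using (isYes≗does; dec-true; dec-false)
  open import Algebra.Properties.CommutativeSemigroup ℤ.+-commutativeSemigroup using (interchange)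

  open SumsOfNaturals using (sum-indicator≡1)

  private
    variable
      A B : Set

  ∑ : (ℕ → ℤ) → ℕ → ℤ
  ∑ f n = sumℤ (applyUpTo f n)

  ∑-cong : ∀ {f g} n → (∀ {t} → t ℕ.< n → f t ≡ g t) → ∑ f n ≡ ∑ g n
  ∑-cong zero    f≡g = refl
  ∑-cong (suc n) f≡g = cong₂ _+_ (f≡g (s≤s z≤n)) (∑-cong n (f≡g ∘ s≤s))

  ∑-+ : ∀ f g n → ∑ (λ t → f t + g t) n ≡ ∑ f n + ∑ g n
  ∑-+ f g zero    = refl
  ∑-+ f g (suc n) =
    trans (cong (_+_ (f 0 + g 0)) (∑-+ (f ∘ suc) (g ∘ suc) n)) (interchange (f 0) (g 0) _ _)

  ∑-neg : ∀ f n → ∑ (λ t → - f t) n ≡ - ∑ f n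
  ∑-neg f zero    = refl
  ∑-neg f (suc n) = trans (cong (_+_ (- f 0)) (∑-neg (f ∘ suc) n)) (sym (ℤ.neg-distrib-+ (f 0) _))

  ∑-minus : ∀ f g n → ∑ (λ t → f t - g t) n ≡ ∑ f n - ∑ g n
  ∑-minus f g n = trans (∑-+ f (-_ ∘ g) n) (cong (_+_ (∑ f n)) (∑-neg g n))

  ∑-split : ∀ f m n → ∑ f (m ℕ.+ n) ≡ ∑ f m + ∑ (λ t → f (m ℕ.+ t)) n
  ∑-split f zero    n = sym (ℤ.+-identityˡ _)
  ∑-split f (suc m) n = trans (cong (_+_ (f 0)) (∑-split (f ∘ suc) m n)) (sym (ℤ.+-assoc (f 0) _ _))

  ∑-suc : ∀ f n → ∑ f (suc n) ≡ ∑ f n + f n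
  ∑-suc f n = begin
    ∑ f (suc n)                   ≡⟨ cong (∑ f) (ℕ.+-comm 1 n) ⟩
    ∑ f (n ℕ.+ 1)                 ≡⟨ ∑-split f n 1 ⟩
    ∑ f n + (f (n ℕ.+ 0) + 0ℤ)    ≡⟨ cong (_+_ (∑ f n)) (trans (ℤ.+-identityʳ _) (cong f (ℕ.+-identityʳ n))) ⟩
    ∑ f n + f n                   ∎
    where open ≡-Reasoning

  ∑-pos : ∀ (f : ℕ → ℕ) n → ∑ (+_ ∘ f) n ≡ + sum (applyUpTo f n)
  ∑-pos f zero    = refl
  ∑-pos f (suc n) = trans (cong (_+_ (+ f 0)) (∑-pos (f ∘ suc) n)) (sym (ℤ.pos-+ (f 0) _))

  indicator-≡ : ∀ t → indicator t t ≡ 1ℤ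
  indicator-≡ t = cong (λ b → if b then 1ℤ else 0ℤ) (trans (isYes≗does (t ≟ t)) (dec-true (t ≟ t) refl))

  indicator-≢ : ∀ {t a} → t ≢ a → indicator t a ≡ 0ℤ
  indicator-≢ {t} {a} t≢a =
    cong (λ b → if b then 1ℤ else 0ℤ) (trans (isYes≗does (t ≟ a)) (dec-false (t ≟ a) t≢a))

  indicator-suc : ∀ t a → indicator (suc t) (suc a) ≡ indicator t a
  indicator-suc t a with t ≟ a
  ... | yes refl = indicator-≡ (suc t)
  ... | no t≢a   = indicator-≢ (t≢a ∘ ℕ.suc-injective)

  0≤indicator : ∀ t a → 0ℤ ≤ indicator t a
  0≤indicator t a with t ≟ a
  ... | yes _ = +≤+ z≤n
  ... | no _  = +≤+ z≤n

  ∑-≡0 : ∀ {f} n → (∀ {t} → t ℕ.< n → f t ≡ 0ℤ) → ∑ f n ≡ 0ℤ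
  ∑-≡0 zero    f≡0 = refl
  ∑-≡0 (suc n) f≡0 = trans (cong₂ _+_ (f≡0 (s≤s z≤n)) (∑-≡0 n (f≡0 ∘ s≤s))) (ℤ.+-identityˡ 0ℤ)

  ∑-indicator-≤ : ∀ m a → m ℕ.≤ a → ∑ (λ t → indicator t a) m ≡ 0ℤ
  ∑-indicator-≤ m a m≤a = ∑-≡0 m (λ t<m → indicator-≢ (ℕ.<⇒≢ (ℕ.<-≤-trans t<m m≤a)))

  ∑-indicator-> : ∀ m a → a ℕ.< m → ∑ (λ t → indicator t a) m ≡ 1ℤ
  ∑-indicator-> (suc m) zero    _         =
    cong₂ _+_ (indicator-≡ 0) (∑-≡0 m (λ {t} _ → indicator-≢ {suc t} {0} (λ ())))
  ∑-indicator-> (suc m) (suc a) (s≤s a<m) = begin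
    indicator 0 (suc a) + ∑ (λ t → indicator (suc t) (suc a)) m
      ≡⟨ cong₂ _+_ (indicator-≢ {0} {suc a} (λ ())) (∑-cong m (λ {t} _ → indicator-suc t a)) ⟩
    0ℤ + ∑ (λ t → indicator t a) m
      ≡⟨ ℤ.+-identityˡ _ ⟩
    ∑ (λ t → indicator t a) m
      ≡⟨ ∑-indicator-> m a a<m ⟩
    1ℤ ∎
    where open ≡-Reasoning

  record FirstMinimum (f : ℕ → ℤ) (K j : ℕ) : Set where
    field
      bounded : j ℕ.≤ K
      minimal : ∀ {m} → m ℕ.≤ K → f j ≤ f m
      first   : ∀ {m} → m ℕ.< j → f j < f m

  open FirstMinimum

  firstMinimum-unique : ∀ {f K i j} → FirstMinimum f K i → FirstMinimum f K j → i ≡ j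
  firstMinimum-unique {i = i} {j} fmᵢ fmⱼ with ℕ.<-cmp i j
  ... | tri< i<j _ _ = contradiction (minimal fmᵢ (bounded fmⱼ)) (ℤ.<⇒≱ (first fmⱼ i<j))
  ... | tri≈ _ i≡j _ = i≡j
  ... | tri> _ _ j<i = contradiction (minimal fmⱼ (bounded fmᵢ)) (ℤ.<⇒≱ (first fmᵢ j<i))

  firstMinimum-exists : ∀ f K → ∃ (FirstMinimum f K)
  firstMinimum-exists f zero    =
    0 , record { bounded = z≤n ; minimal = λ { z≤n → ℤ.≤-refl } ; first = λ () }
  firstMinimum-exists f (suc K) with firstMinimum-exists f K
  ... | j , fmⱼ with f (suc K) ℤ.<? f j
  ...   | yes fK<fj = suc K , record { bounded = ℕ.≤-refl ; minimal = minimal′ ; first = first′ }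
    where
    first′ : ∀ {m} → m ℕ.< suc K → f (suc K) < f m
    first′ (s≤s m≤K) = ℤ.<-≤-trans fK<fj (minimal fmⱼ m≤K)
    minimal′ : ∀ {m} → m ℕ.≤ suc K → f (suc K) ≤ f m
    minimal′ m≤K+1 with ℕ.m≤n⇒m<n∨m≡n m≤K+1
    ... | inj₁ m<K+1 = ℤ.<⇒≤ (first′ m<K+1)
    ... | inj₂ refl  = ℤ.≤-refl
  ...   | no  fK≮fj =
    j , record { bounded = ℕ.m≤n⇒m≤1+n (bounded fmⱼ) ; minimal = minimal′ ; first = first fmⱼ }
    where
    minimal′ : ∀ {m} → m ℕ.≤ suc K → f j ≤ f m
    minimal′ m≤K+1 with ℕ.m≤n⇒m<n∨m≡n m≤K+1
    ... | inj₁ (s≤s m≤K) = minimal fmⱼ m≤K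
    ... | inj₂ refl      = ℤ.≮⇒≥ fK≮fj

  nth-map : ∀ (f : A → B) a xs t → nth (f a) (map f xs) t ≡ f (nth a xs t)
  nth-map f a []       t       = refl
  nth-map f a (x ∷ xs) zero    = refl
  nth-map f a (x ∷ xs) (suc t) = nth-map f a xs t

  nth-toList : ∀ {n} a (v : Vec A n) i → nth a (toList v) (toℕ i) ≡ lookup v i
  nth-toList a (x Vec.∷ v) Fin.zero    = refl
  nth-toList a (x Vec.∷ v) (Fin.suc i) = nth-toList a v i

  nth-toList-< : ∀ {n t} a (v : Vec A n) (t<n : t ℕ.< n) → nth a (toList v) t ≡ lookup v (fromℕ< t<n)
  nth-toList-< a v t<n = trans (cong (nth a (toList v)) (sym (toℕ-fromℕ< t<n))) (nth-toList a v (fromℕ< t<n))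

  sum-applyUpTo-nth : ∀ {n} (v : Vec ℕ n) → sum (applyUpTo (nth 0 (toList v)) n) ≡ sum (toList v)
  sum-applyUpTo-nth Vec.[]      = refl
  sum-applyUpTo-nth (x Vec.∷ v) = cong (x ℕ.+_) (sum-applyUpTo-nth v)

  ≤-by-difference : ∀ {a b x y} → b - a ≡ y - x → a ≤ b → x ≤ y
  ≤-by-difference eq a≤b = ℤ.0≤i-j⇒j≤i (subst (0ℤ ≤_) eq (ℤ.i≤j⇒0≤j-i a≤b))

  +-cancelˡ-≤ : ∀ i {j k} → i + j ≤ i + k → j ≤ k
  +-cancelˡ-≤ i {j} {k} le = subst₂ _≤_ (cancel j) (cancel k) (ℤ.+-monoʳ-≤ (- i) le)
    where
    cancel : ∀ x → - i + (i + x) ≡ x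
    cancel x = trans (sym (ℤ.+-assoc (- i) i x)) (trans (cong (_+ x) (ℤ.+-inverseˡ i)) (ℤ.+-identityˡ x))

  endpoint-form : ∀ {R : ℕ → Set} j K →
    (∀ {i} → i ℕ.< K → R (j ℕ.+ suc i)) ⇔ (∀ {m} → j ℕ.< m → m ℕ.≤ j ℕ.+ K → R m)
  endpoint-form {R} j K = mk⇔ to from
    where
    to : (∀ {i} → i ℕ.< K → R (j ℕ.+ suc i)) → ∀ {m} → j ℕ.< m → m ℕ.≤ j ℕ.+ K → R m
    to steps {m} j<m m≤j+K = subst R j+[1+i]≡m (steps i<K)
      where
      i = m ∸ suc j
      j+[1+i]≡m : j ℕ.+ suc i ≡ m
      j+[1+i]≡m = trans (ℕ.+-suc j i) (ℕ.m+[n∸m]≡n j<m)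
      i<K : i ℕ.< K
      i<K = subst (i ℕ.<_) (ℕ.m+n∸m≡n (suc j) K) (ℕ.∸-monoˡ-< (s≤s m≤j+K) j<m)
    from : (∀ {m} → j ℕ.< m → m ℕ.≤ j ℕ.+ K → R m) → ∀ {i} → i ℕ.< K → R (j ℕ.+ suc i)
    from ends i<K = ends (ℕ.m<m+n j (s≤s z≤n)) (ℕ.+-monoʳ-≤ j i<K)

  nonNeg-intro : ∀ {n} (v : Vec ℤ n) → (∀ i → 0ℤ ≤ lookup v i) → T (nonNeg v)
  nonNeg-intro v 0≤v = all⁻ (0ℤ ≤ᵇ_) (toList⁺ {xs = v} (lookup⁻ (ℤ.≤⇒≤ᵇ ∘ 0≤v)))

  module Rotation {K : ℕ} (c d : Vec ℕ (suc K)) (Σc≡Σd : sum (toList c) ≡ sum (toList d)) where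

    private
      k : ℕ
      k = suc K

    cₜ dₜ : ℕ → ℕ
    cₜ = nth 0 (toList c)
    dₜ = nth 0 (toList d)

    Q : ℕ → ℤ
    Q = ∑ (λ t → + dₜ t - + cₜ t)

    entry : ℕ → ℕ → ℤ
    entry j = nth (+ 0) (toList (cvec c j))

    P : ℕ → ℕ → ℤ
    P j = ∑ (λ t → + dₜ (t % k) - entry j (t % k))

    entry-zero : ∀ t → entry 0 t ≡ + cₜ t
    entry-zero t = trans (cong (λ xs → nth (+ 0) xs t) (toList-map +_ c)) (nth-map +_ 0 (toList c) t)

    -- cvec c (suc j) is tabulate (shifted j).
    shifted : ℕ → Fin k → ℤ
    shifted j i = (+ lookup c i + indicator (toℕ i) K) - indicator (toℕ i) j

    entry-suc : ∀ j {t} → t ℕ.< k → entry (suc j) t ≡ (+ cₜ t + indicator t K) - indicator t j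
    entry-suc j {t} t<k = begin
      entry (suc j) t
        ≡⟨ nth-toList-< (+ 0) (tabulate (shifted j)) t<k ⟩
      lookup (tabulate (shifted j)) i
        ≡⟨ lookup∘tabulate (shifted j) i ⟩
      shifted j i
        ≡⟨ cong₂ (λ x s → (+ x + indicator s K) - indicator s j) (sym (nth-toList-< 0 c t<k)) (toℕ-fromℕ< t<k) ⟩
      (+ cₜ t + indicator t K) - indicator t j ∎
      where
      open ≡-Reasoning
      i = fromℕ< t<k

    P-zero : ∀ {m} → m ℕ.≤ k → P 0 m ≡ Q m
    P-zero {m} m≤k = ∑-cong m λ {t} t<m → begin
      + dₜ (t % k) - entry 0 (t % k) ≡⟨ cong (λ s → + dₜ s - entry 0 s) (m<n⇒m%n≡m (ℕ.<-≤-trans t<m m≤k)) ⟩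
      + dₜ t - entry 0 t             ≡⟨ cong (_-_ (+ dₜ t)) (entry-zero t) ⟩
      + dₜ t - + cₜ t                ∎
      where open ≡-Reasoning

    P-suc : ∀ j {m} → m ℕ.≤ k →
      P (suc j) m ≡ (Q m - ∑ (λ t → indicator t K) m) + ∑ (λ t → indicator t j) m
    P-suc j {m} m≤k = begin
      P (suc j) m
        ≡⟨ ∑-cong m term ⟩
      ∑ (λ t → (x t - indicator t K) + indicator t j) m
        ≡⟨ ∑-+ (λ t → x t - indicator t K) (λ t → indicator t j) m ⟩
      ∑ (λ t → x t - indicator t K) m + ∑ (λ t → indicator t j) m
        ≡⟨ cong (λ s → s + ∑ (λ t → indicator t j) m) (∑-minus x (λ t → indicator t K) m) ⟩
      (Q m - ∑ (λ t → indicator t K) m) + ∑ (λ t → indicator t j) m ∎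
      where
      open ≡-Reasoning
      x : ℕ → ℤ
      x t = + dₜ t - + cₜ t
      term : ∀ {t} → t ℕ.< m → + dₜ (t % k) - entry (suc j) (t % k) ≡ (x t - indicator t K) + indicator t j
      term {t} t<m = begin
        + dₜ (t % k) - entry (suc j) (t % k)
          ≡⟨ cong (λ s → + dₜ s - entry (suc j) s) (m<n⇒m%n≡m t<k) ⟩
        + dₜ t - entry (suc j) t
          ≡⟨ cong (_-_ (+ dₜ t)) (entry-suc j t<k) ⟩
        + dₜ t - ((+ cₜ t + indicator t K) - indicator t j)
          ≡⟨ rearrange (+ dₜ t) (+ cₜ t) (indicator t K) (indicator t j) ⟩
        (x t - indicator t K) + indicator t j ∎
        where
        t<k = ℕ.<-≤-trans t<m m≤k
        rearrange : ∀ a b u v → a - ((b + u) - v) ≡ ((a - b) - u) + v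
        rearrange = solve-∀

    offset : ℕ → ℤ
    offset zero    = 0ℤ
    offset (suc _) = 1ℤ

    P-above : ∀ {j m} → j ℕ.≤ m → m ℕ.≤ K → P j m ≡ offset j + Q m
    P-above {zero}        _   m≤K = trans (P-zero (ℕ.m≤n⇒m≤1+n m≤K)) (sym (ℤ.+-identityˡ _))
    P-above {suc j} {m} j<m m≤K = begin
      P (suc j) m
        ≡⟨ P-suc j (ℕ.m≤n⇒m≤1+n m≤K) ⟩
      (Q m - ∑ (λ t → indicator t K) m) + ∑ (λ t → indicator t j) m
        ≡⟨ cong₂ (λ u v → (Q m - u) + v) (∑-indicator-≤ m K m≤K) (∑-indicator-> m j j<m) ⟩
      (Q m - 0ℤ) + 1ℤ
        ≡⟨ simplify (Q m) ⟩
      1ℤ + Q m ∎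
      where
      open ≡-Reasoning
      simplify : ∀ q → (q - 0ℤ) + 1ℤ ≡ 1ℤ + q
      simplify = solve-∀

    P-below : ∀ {j m} → m ℕ.< j → j ℕ.≤ K → P j m ≡ Q m
    P-below {suc j} {m} (s≤s m≤j) j<K = begin
      P (suc j) m
        ≡⟨ P-suc j (ℕ.m≤n⇒m≤1+n m≤K) ⟩
      (Q m - ∑ (λ t → indicator t K) m) + ∑ (λ t → indicator t j) m
        ≡⟨ cong₂ (λ u v → (Q m - u) + v) (∑-indicator-≤ m K m≤K) (∑-indicator-≤ m j m≤j) ⟩
      (Q m - 0ℤ) + 0ℤ
        ≡⟨ simplify (Q m) ⟩
      Q m ∎
      where
      open ≡-Reasoning
      m≤K = ℕ.≤-trans m≤j (ℕ.<⇒≤ j<K)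
      simplify : ∀ q → (q - 0ℤ) + 0ℤ ≡ q
      simplify = solve-∀

    Q-full : Q k ≡ 0ℤ
    Q-full = begin
      ∑ (λ t → + dₜ t - + cₜ t) k
        ≡⟨ ∑-minus (+_ ∘ dₜ) (+_ ∘ cₜ) k ⟩
      ∑ (+_ ∘ dₜ) k - ∑ (+_ ∘ cₜ) k
        ≡⟨ cong₂ _-_ (∑-pos dₜ k) (∑-pos cₜ k) ⟩
      + sum (applyUpTo dₜ k) - + sum (applyUpTo cₜ k)
        ≡⟨ cong₂ (λ u v → + u - + v) (sum-applyUpTo-nth d) (sum-applyUpTo-nth c) ⟩
      + sum (toList d) - + sum (toList c)
        ≡⟨ cong (λ u → + u - + sum (toList c)) (sym Σc≡Σd) ⟩
      + sum (toList c) - + sum (toList c)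
        ≡⟨ ℤ.+-inverseʳ (+ sum (toList c)) ⟩
      0ℤ ∎
      where open ≡-Reasoning

    P-full : ∀ {j} → j ℕ.< k → P j k ≡ 0ℤ
    P-full {zero}  _         = trans (P-zero ℕ.≤-refl) Q-full
    P-full {suc j} (s≤s j<K) = begin
      P (suc j) k
        ≡⟨ P-suc j ℕ.≤-refl ⟩
      (Q k - ∑ (λ t → indicator t K) k) + ∑ (λ t → indicator t j) k
        ≡⟨ cong₂ (λ u v → (Q k - u) + v) (∑-indicator-> k K ℕ.≤-refl) (∑-indicator-> k j (ℕ.m≤n⇒m≤1+n j<K)) ⟩
      (Q k - 1ℤ) + 1ℤ
        ≡⟨ cong (λ q → (q - 1ℤ) + 1ℤ) Q-full ⟩
      0ℤ ∎
      where open ≡-Reasoning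

    P-periodic : ∀ {j} → j ℕ.< k → ∀ m → P j (k ℕ.+ m) ≡ P j m
    P-periodic {j} j<k m = begin
      P j (k ℕ.+ m)
        ≡⟨ ∑-split y k m ⟩
      P j k + ∑ (λ t → y (k ℕ.+ t)) m
        ≡⟨ cong₂ _+_ (P-full j<k) (∑-cong m (λ {t} _ → cong (λ s → + dₜ s - entry j s) (k+t%k≡t%k t))) ⟩
      0ℤ + P j m
        ≡⟨ ℤ.+-identityˡ (P j m) ⟩
      P j m ∎
      where
      open ≡-Reasoning
      y : ℕ → ℤ
      y t = + dₜ (t % k) - entry j (t % k)
      k+t%k≡t%k : ∀ t → (k ℕ.+ t) % k ≡ t % k
      k+t%k≡t%k t = trans (cong (_% k) (ℕ.+-comm k t)) ([m+n]%n≡m%n t k)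

    window-above : ∀ {j m} → j ℕ.≤ m → m ℕ.≤ K → P j j ≤ P j m ⇔ Q j ≤ Q m
    window-above {j} {m} j≤m m≤K = mk⇔
      (λ Pj≤Pm → +-cancelˡ-≤ (offset j) (subst₂ _≤_ Pj≡ Pm≡ Pj≤Pm))
      (λ Qj≤Qm → subst₂ _≤_ (sym Pj≡) (sym Pm≡) (ℤ.+-monoʳ-≤ (offset j) Qj≤Qm))
      where
      Pj≡ = P-above ℕ.≤-refl (ℕ.≤-trans j≤m m≤K)
      Pm≡ = P-above j≤m m≤K

    window-wrapped : ∀ {j m} → m ℕ.< j → j ℕ.≤ K → P j j ≤ P j (k ℕ.+ m) ⇔ Q j < Q m
    window-wrapped {suc j} {m} m<j j<K = mk⇔
      (λ Pj≤Pkm → ℤ.suc[i]≤j⇒i<j (subst₂ _≤_ Pj≡ Pkm≡ Pj≤Pkm))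
      (λ Qj<Qm → subst₂ _≤_ (sym Pj≡) (sym Pkm≡) (ℤ.i<j⇒suc[i]≤j Qj<Qm))
      where
      Pj≡ = P-above ℕ.≤-refl j<K
      Pkm≡ = trans (P-periodic (s≤s j<K) m) (P-below m<j j<K)

    Windows : ℕ → Set
    Windows j = ∀ {m} → j ℕ.< m → m ℕ.≤ j ℕ.+ K → P j j ≤ P j m

    windows⇒firstMinimum : ∀ {j} → j ℕ.≤ K → Windows j → FirstMinimum Q K j
    windows⇒firstMinimum {j} j≤K windows = record { bounded = j≤K ; minimal = minimal′ ; first = first′ }
      where
      first′ : ∀ {m} → m ℕ.< j → Q j < Q m
      first′ {m} m<j = Equivalence.to (window-wrapped m<j j≤K) (windows j<k+m k+m≤j+K)
        where
        j<k+m : j ℕ.< k ℕ.+ m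
        j<k+m = s≤s (ℕ.≤-trans j≤K (ℕ.m≤m+n K m))
        k+m≤j+K : k ℕ.+ m ℕ.≤ j ℕ.+ K
        k+m≤j+K = subst₂ ℕ._≤_ (ℕ.+-suc K m) (ℕ.+-comm K j) (ℕ.+-monoʳ-≤ K m<j)
      minimal′ : ∀ {m} → m ℕ.≤ K → Q j ≤ Q m
      minimal′ {m} m≤K with ℕ.<-cmp m j
      ... | tri< m<j _ _  = ℤ.<⇒≤ (first′ m<j)
      ... | tri≈ _ refl _ = ℤ.≤-refl
      ... | tri> _ _ j<m  =
        Equivalence.to (window-above (ℕ.<⇒≤ j<m) m≤K) (windows j<m (ℕ.≤-trans m≤K (ℕ.m≤n+m K j)))

    firstMinimum⇒windows : ∀ {j} → FirstMinimum Q K j → Windows j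
    firstMinimum⇒windows {j} fm {m} j<m m≤j+K with m ℕ.≤? K
    ... | yes m≤K = Equivalence.from (window-above (ℕ.<⇒≤ j<m) m≤K) (minimal fm m≤K)
    ... | no  m≰K = subst (λ n → P j j ≤ P j n) (ℕ.m+[n∸m]≡n k≤m)
                      (Equivalence.from (window-wrapped m∸k<j (bounded fm)) (first fm m∸k<j))
      where
      k≤m : k ℕ.≤ m
      k≤m = ℕ.≰⇒> m≰K
      m∸k<j : m ∸ k ℕ.< j
      m∸k<j = subst (m ∸ k ℕ.<_) (ℕ.m+n∸m≡n k j)
                (ℕ.∸-monoˡ-< (s≤s (subst (m ℕ.≤_) (ℕ.+-comm j K) m≤j+K)) k≤m)

    -- inC c j d unfolds to nonNeg (cvec c j) ∧ all (windowTest j) (upTo K).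
    windowTest : ℕ → ℕ → Bool
    windowTest j i = sumℤ (map (λ t → entry j ((j ℕ.+ t) % k)) (upTo (suc i)))
                     ≤ᵇ sumℤ (map (λ t → + dₜ ((j ℕ.+ t) % k)) (upTo (suc i)))

    window-sum : ∀ j n → ∑ (λ t → + dₜ ((j ℕ.+ t) % k)) n - ∑ (λ t → entry j ((j ℕ.+ t) % k)) n
                         ≡ P j (j ℕ.+ n) - P j j
    window-sum j n = begin
      ∑ (λ t → + dₜ ((j ℕ.+ t) % k)) n - ∑ (λ t → entry j ((j ℕ.+ t) % k)) n
        ≡⟨ ∑-minus (λ t → + dₜ ((j ℕ.+ t) % k)) (λ t → entry j ((j ℕ.+ t) % k)) n ⟨
      ∑ (λ t → y (j ℕ.+ t)) n
        ≡⟨ b≡[a+b]-a (P j j) (∑ (λ t → y (j ℕ.+ t)) n) ⟩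
      (P j j + ∑ (λ t → y (j ℕ.+ t)) n) - P j j
        ≡⟨ cong (λ s → s - P j j) (∑-split y j n) ⟨
      P j (j ℕ.+ n) - P j j ∎
      where
      open ≡-Reasoning
      y : ℕ → ℤ
      y t = + dₜ (t % k) - entry j (t % k)
      b≡[a+b]-a : ∀ a b → b ≡ (a + b) - a
      b≡[a+b]-a = solve-∀

    windowTest⇔ : ∀ j i → T (windowTest j i) ⇔ P j j ≤ P j (j ℕ.+ suc i)
    windowTest⇔ j i = mk⇔
      (λ test → ≤-by-difference (window-sum j (suc i)) (subst₂ _≤_ E≡ D≡ (ℤ.≤ᵇ⇒≤ test)))
      (λ Pj≤ → ℤ.≤⇒≤ᵇ (subst₂ _≤_ (sym E≡) (sym D≡) (≤-by-difference (sym (window-sum j (suc i))) Pj≤)))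
      where
      E≡ = cong sumℤ (map-upTo (λ t → entry j ((j ℕ.+ t) % k)) (suc i))
      D≡ = cong sumℤ (map-upTo (λ t → + dₜ ((j ℕ.+ t) % k)) (suc i))

    inC⇒windows : ∀ j → T (inC c j d) → ∀ {i} → i ℕ.< K → P j j ≤ P j (j ℕ.+ suc i)
    inC⇒windows j d∈Cⱼ {i} i<K =
      Equivalence.to (windowTest⇔ j i)
        (applyUpTo⁻ (λ i → i) K (all⁺ (windowTest j) (upTo K) (proj₂ (Equivalence.to T-∧ d∈Cⱼ))) i<K)

    windows⇒inC : ∀ j → T (nonNeg (cvec c j)) → (∀ {i} → i ℕ.< K → P j j ≤ P j (j ℕ.+ suc i)) →
      T (inC c j d)
    windows⇒inC j nonNeg-cⱼ windows = Equivalence.from T-∧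
      (nonNeg-cⱼ , all⁻ (windowTest j)
                     (applyUpTo⁺₁ (λ i → i) K (λ {i} i<K → Equivalence.from (windowTest⇔ j i) (windows i<K))))

    firstMinimum⇒0<cₜ : ∀ {j} → FirstMinimum Q K (suc j) → 0 ℕ.< cₜ j
    firstMinimum⇒0<cₜ {j} fm with cₜ j in cⱼ≡
    ... | suc _ = s≤s z≤n
    ... | zero  = contradiction (first fm (ℕ.n<1+n j)) (ℤ.≤⇒≯ Qj≤Q[1+j])
      where
      Qj≤Q[1+j] : Q j ≤ Q (suc j)
      Qj≤Q[1+j] = subst (Q j ≤_)
        (sym (trans (∑-suc (λ t → + dₜ t - + cₜ t) j) (cong (λ x → Q j + (+ dₜ j - + x)) cⱼ≡)))
        (ℤ.i≤i+j (Q j) (+ dₜ j - + 0))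

    firstMinimum⇒nonNeg : ∀ {j} → FirstMinimum Q K j → T (nonNeg (cvec c j))
    firstMinimum⇒nonNeg {zero}  _  =
      nonNeg-intro (Vec.map +_ c) (λ i → subst (0ℤ ≤_) (sym (lookup-map i +_ c)) (+≤+ z≤n))
    firstMinimum⇒nonNeg {suc j} fm =
      nonNeg-intro (tabulate (shifted j)) (λ i → subst (0ℤ ≤_) (sym (lookup∘tabulate (shifted j) i)) (0≤shifted i))
      where
      0≤shifted : ∀ i → 0ℤ ≤ shifted j i
      0≤shifted i with toℕ i ≟ j
      ... | no  _    = subst (0ℤ ≤_) (sym (ℤ.+-identityʳ _)) (ℤ.+-mono-≤ (+≤+ z≤n) (0≤indicator (toℕ i) K))
      ... | yes refl = begin
        0ℤ
          ≤⟨ ℤ.i≤j⇒0≤j-i (+≤+ (firstMinimum⇒0<cₜ fm)) ⟩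
        + cₜ (toℕ i) - 1ℤ
          ≡⟨ cong (λ u → u - 1ℤ) (trans (ℤ.+-identityʳ (+ lookup c i)) (cong +_ (sym (nth-toList 0 c i)))) ⟨
        (+ lookup c i + 0ℤ) - 1ℤ
          ≡⟨ cong (λ v → (+ lookup c i + v) - 1ℤ) (indicator-≢ (ℕ.<⇒≢ (bounded fm))) ⟨
        (+ lookup c i + indicator (toℕ i) K) - 1ℤ ∎
        where open ℤ.≤-Reasoning

    inC⇔firstMinimum : ∀ {j} → j ℕ.< k → T (inC c j d) ⇔ FirstMinimum Q K j
    inC⇔firstMinimum {j} (s≤s j≤K) = mk⇔
      (λ d∈Cⱼ → windows⇒firstMinimum j≤K (Equivalence.to endpoints (inC⇒windows j d∈Cⱼ)))
      (λ fm → windows⇒inC j (firstMinimum⇒nonNeg fm) (Equivalence.from endpoints (firstMinimum⇒windows fm)))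
      where
      endpoints = endpoint-form {λ m → P j j ≤ P j m} j K

    exactly-one-rotation : sum (map (λ j → if inC c j d then 1 else 0) (upTo k)) ≡ 1
    exactly-one-rotation =
      trans (cong sum (map-upTo (λ j → if inC c j d then 1 else 0) k))
            (sum-indicator≡1 (λ j → inC c j d) k (s≤s (bounded fm₀)) inC⇔j≡j₀)
      where
      j₀ = proj₁ (firstMinimum-exists Q K)
      fm₀ = proj₂ (firstMinimum-exists Q K)
      inC⇔j≡j₀ : ∀ {j} → j ℕ.< k → T (inC c j d) ⇔ j ≡ j₀
      inC⇔j≡j₀ j<k = mk⇔
        (λ d∈Cⱼ → firstMinimum-unique (Equivalence.to (inC⇔firstMinimum j<k) d∈Cⱼ) fm₀)
        (λ { refl → Equivalence.from (inC⇔firstMinimum j<k) fm₀ })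

open import Data.Bool using (if_then_else_)
open import Data.Nat using (ℕ; zero; suc; _*_; _^_; _≤_; _≟_)
open import Data.Nat.ListAction using (sum)
open import Data.Nat.Properties using (*-identityʳ)
open import Data.List using (map; upTo)
open import Data.Vec using (Vec; toList)
open import Function using (_∘_)
open import Relation.Binary.PropositionalEquality using (_≡_; sym; trans; cong; module ≡-Reasoning)
open SumsOfNaturals using (sum-map-cong; sum-map-filter-cong; double-counting)
open MultinomialTheorem using (multinomial-theorem)
open CycleLemma using (module Rotation)

corollary3p23 : (N k : ℕ) → 1 ≤ N → 2 ≤ k → (c : Vec ℕ k) → sumℕ (toList c) ≡ N →
    sumℕ (map (S N k c) (upTo k)) ≡ k ^ N
corollary3p23 N zero    _ ()
corollary3p23 N (suc K) _ _  c Σc≡N = begin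
  sum (map (S N k c) (upTo k))
    ≡⟨ double-counting (inC c) (multinomial N ∘ toList) (upTo k) (comps N k) ⟩
  sum (map (λ d → multinomial N (toList d) * sum (map (λ j → if inC c j d then 1 else 0) (upTo k))) (comps N k))
    ≡⟨ sum-map-filter-cong (λ d → sum (toList d) ≟ N) (λ {d} Σd≡N → cong (multinomial N (toList d) *_)
         (Rotation.exactly-one-rotation c d (trans Σc≡N (sym Σd≡N)))) (box N k) ⟩
  sum (map (λ d → multinomial N (toList d) * 1) (comps N k))
    ≡⟨ sum-map-cong (λ d → *-identityʳ (multinomial N (toList d))) (comps N k) ⟩
  sum (map (multinomial N ∘ toList) (comps N k))
    ≡⟨ multinomial-theorem N k ⟩
  k ^ N ∎
  where
  open ≡-Reasoning
  k = suc K
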